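{- Let $G$ be a finite simple undirected graph and let $\mathcal{X}\subseteq\mathcal{C}_{\mathcal{R}}$ be a set of relevant cycles all of the same length. Then $\mathcal{X}$ is not mutually relevant if and only if there exist $k\ge1$ pairwise distinct cycles $C_1,\ldots,C_k\in\mathcal{X}$ and a finite set $\mathcal{Y}$ of cycles with $|C|<|C_1|$ for all $C\in\mathcal{Y}$ such that $C_1\oplus C_2\oplus\cdots\oplus C_k=\bigoplus_{C\in\mathcal{Y}}C$.
   Context: Let $G=(V,E)$ be a finite simple undirected graph. A cycle is a set $C\subseteq E$ such that every vertex of $G$ has even degree in the subgraph with edge set $C$; $|C|$ denotes the number of edges. The cycles form a vector space over $GF(2)$ under symmetric difference $\oplus$ (an empty sum is $\emptyset$). A minimum cycle basis (MCB) is a basis $\mathcal{M}$ of this space minimizing $\sum_{B\in\mathcal{M}}|B|$. The set of relevant cycles $\mathcal{C}_{\mathcal{R}}$ is the union of all MCBs. A set of cycles $\mathcal{X}$ is mutually relevant if there exists an MCB $\mathcal{M}$ with $\mathcal{X}\subseteq\mathcal{M}$. -}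

module Defs where

open import Data.Nat using (ℕ; zero; suc; _+_; _≤_; _<_; _%_)
open import Data.Nat.ListAction using (sum)
open import Data.Bool using (Bool; true; false; _∧_; _∨_; _xor_; if_then_else_)
open import Data.Fin using (Fin; _≟_)
open import Data.Fin.Subset using (Subset; ∣_∣)
open import Data.Vec using (Vec; []; _∷_; zipWith; replicate; lookup)
open import Data.List using (List; []; _∷_; length; map; allFin; foldr)
open import Data.List.Membership.Propositional using (_∈_)
open import Data.List.Relation.Unary.All using (All)
open import Data.Sum using (_⊎_)
open import Data.Product using (_×_; _,_; proj₁; proj₂; Σ; ∃)
open import Relation.Binary.PropositionalEquality using (_≡_; _≢_)
open import Relation.Nullary using (¬_)
open import Relation.Nullary.Decidable using (⌊_⌋)

record Graph : Set where
  field
    n m   : ℕ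
    ends  : Fin m → Fin n × Fin n
    loopless : ∀ e → proj₁ (ends e) ≢ proj₂ (ends e)
    -- no parallel edges (edges are unordered pairs)
    simple : ∀ e f →
      ((proj₁ (ends e) ≡ proj₁ (ends f) × proj₂ (ends e) ≡ proj₂ (ends f))
        ⊎ (proj₁ (ends e) ≡ proj₂ (ends f) × proj₂ (ends e) ≡ proj₁ (ends f)))
      → e ≡ f

open Graph public

EdgeSet : Graph → Set
EdgeSet G = Subset (m G)

_⊕_ : ∀ {k} → Subset k → Subset k → Subset k
_⊕_ = zipWith _xor_

∅ : ∀ {k} → Subset k
∅ = replicate _ false

⨁ : ∀ {k} → List (Subset k) → Subset k
⨁ = foldr _⊕_ ∅

size : ∀ {k} → Subset k → ℕ
size = ∣_∣

lookupB : ∀ {k} → Subset k → Fin k → Bool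
lookupB = lookup

incident : (G : Graph) → Fin (n G) → Fin (m G) → Bool
incident G v e = ⌊ proj₁ (ends G e) ≟ v ⌋ ∨ ⌊ proj₂ (ends G e) ≟ v ⌋

degree : (G : Graph) → EdgeSet G → Fin (n G) → ℕ
degree G C v =
  sum (map (λ e → if lookupB C e ∧ incident G v e then 1 else 0) (allFin (m G)))

IsCycle : (G : Graph) → EdgeSet G → Set
IsCycle G C = ∀ v → degree G C v % 2 ≡ 0

lincomb : ∀ {k} (B : List (Subset k)) → Vec Bool (length B) → Subset k
lincomb []      []       = ∅
lincomb (b ∷ B) (c ∷ cs) = (if c then b else ∅) ⊕ lincomb B cs

LinIndep : ∀ {k} → List (Subset k) → Set
LinIndep B = ∀ cs → lincomb B cs ≡ ∅ → cs ≡ replicate _ false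

IsCycleBasis : (G : Graph) → List (EdgeSet G) → Set
IsCycleBasis G B =
  All (IsCycle G) B × LinIndep B ×
  (∀ C → IsCycle G C → ∃ λ cs → lincomb B cs ≡ C)

weight : ∀ {k} → List (Subset k) → ℕ
weight B = sum (map size B)

IsMCB : (G : Graph) → List (EdgeSet G) → Set
IsMCB G B = IsCycleBasis G B × (∀ B' → IsCycleBasis G B' → weight B ≤ weight B')

IsRelevant : (G : Graph) → EdgeSet G → Set
IsRelevant G C = ∃ λ M → IsMCB G M × C ∈ M

-- a (finite) set of cycles, given by a list, is mutually relevant
MutuallyRelevant : (G : Graph) → List (EdgeSet G) → Set
MutuallyRelevant G X = ∃ λ M → IsMCB G M × (∀ C → C ∈ X → C ∈ M)

-- The argument rests on the exchange property of a basis b ∷ R of the cycle space: if the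
-- expansion of a cycle C over the basis uses b (that is, b ⊕ C lies in the span of R), then
-- C ∷ R is again a cycle basis. For a minimum cycle basis this forces |b| ≤ |C|, and C ∷ R is
-- again minimum as soon as |C| ≤ |b|. Any basis element can be brought to the head by a
-- permutation, which preserves spans, independence and weight.
--
-- (⇐) If X lies in an MCB M, then every cycle shorter than C₁ expands over M without using C₁,
-- and so do C₂, …, C_k; so would C₁ = C₂ ⊕ ⋯ ⊕ C_k ⊕ ⨁ Y, contradicting independence.
--
-- (⇒) Insert the members of X one by one into an MCB. A member C not yet in the current MCB M
-- expands over M. If the expansion uses a b that is neither shorter than C nor an earlier member
-- of X, exchanging b for C keeps M minimum and keeps the earlier members. Otherwise C is the sum
-- of earlier members of X and of cycles shorter than C, which is the required relation.

module Submission where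

open import Defs
open import Data.Bool as Bool using (Bool; true; false; _xor_; if_then_else_)
open import Data.Bool.Properties using (xor-assoc; xor-comm; xor-identityˡ; xor-identityʳ; xor-same)
open import Data.Empty using (⊥; ⊥-elim)
open import Data.Fin.Properties using (all?)
open import Data.Fin.Subset using (Subset)
open import Data.Fin.Subset.Properties using (anySubset?)
open import Data.List using (List; []; _∷_; length; _++_; map; filter)
open import Data.List.Membership.Propositional using (_∈_)
open import Data.List.Membership.Propositional.Properties
  using (∈-∃++; ∈-++⁺ˡ; ∈-++⁺ʳ; ∈-map⁺)
open import Data.List.Relation.Binary.Permutation.Propositional as ↭ using (_↭_; ↭-sym)
open import Data.List.Relation.Binary.Permutation.Propositional.Properties
  using (∈-resp-↭; All-resp-↭; map⁺; shift)
open import Data.List.Relation.Unary.All as All using (All; []; _∷_)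
open import Data.List.Relation.Unary.All.Properties using (all-filter; filter⁺)
open import Data.List.Relation.Unary.AllPairs using ([]; _∷_)
open import Data.List.Relation.Unary.Any using (here; there; any?)
open import Data.List.Relation.Unary.Unique.Propositional using (Unique)
import Data.List.Relation.Unary.Unique.Propositional.Properties as Unique
open import Data.Nat as ℕ using (ℕ; zero; suc; _≤_; _<_; _%_; _<?_)
open import Data.Nat.Induction using (<-wellFounded)
open import Data.Nat.ListAction.Properties using (sum-↭)
open import Data.Nat.Properties using (≤-trans; +-monoˡ-≤; +-cancelʳ-≤; <⇒≱; ≮⇒≥)
open import Data.Product using (Σ; _×_; _,_; proj₂)
open import Data.Sum as Sum using (_⊎_; inj₁; inj₂)
open import Data.Vec using (Vec; []; _∷_; replicate)
open import Data.Vec.Properties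
  using (≡-dec; ∷-injectiveʳ; zipWith-assoc; zipWith-comm; zipWith-identityˡ; zipWith-identityʳ)
open import Function using (_∘_)
open import Function.Bundles using (_⇔_; mk⇔)
open import Induction.WellFounded using (Acc; acc)
open import Level using (0ℓ)
open import Relation.Binary.PropositionalEquality
  using (_≡_; _≢_; refl; sym; trans; cong; cong₂; subst; module ≡-Reasoning)
open import Relation.Nullary using (¬_; ¬?; Dec; yes; no)
open import Relation.Nullary.Decidable using (_⊎-dec_; map′)
open import Relation.Unary using (Pred; Decidable)

open ≡-Reasoning

private variable
  k : ℕ
  x y b S T : Subset k
  L L′ R : List (Subset k)

⊕-assoc : (x y z : Subset k) → (x ⊕ y) ⊕ z ≡ x ⊕ (y ⊕ z)
⊕-assoc = zipWith-assoc xor-assoc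

⊕-comm : (x y : Subset k) → x ⊕ y ≡ y ⊕ x
⊕-comm = zipWith-comm xor-comm

⊕-identityˡ : (x : Subset k) → ∅ ⊕ x ≡ x
⊕-identityˡ = zipWith-identityˡ xor-identityˡ

⊕-identityʳ : (x : Subset k) → x ⊕ ∅ ≡ x
⊕-identityʳ = zipWith-identityʳ xor-identityʳ

⊕-self : (x : Subset k) → x ⊕ x ≡ ∅
⊕-self []      = refl
⊕-self (a ∷ x) = cong₂ _∷_ (xor-same a) (⊕-self x)

⊕-cancelˡ : (x y : Subset k) → x ⊕ (x ⊕ y) ≡ y
⊕-cancelˡ x y = begin
  x ⊕ (x ⊕ y) ≡⟨ ⊕-assoc x x y ⟨
  (x ⊕ x) ⊕ y ≡⟨ cong (_⊕ y) (⊕-self x) ⟩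
  ∅ ⊕ y       ≡⟨ ⊕-identityˡ y ⟩
  y           ∎

⊕-cancelʳ : (x y : Subset k) → (x ⊕ y) ⊕ y ≡ x
⊕-cancelʳ x y = begin
  (x ⊕ y) ⊕ y ≡⟨ ⊕-assoc x y y ⟩
  x ⊕ (y ⊕ y) ≡⟨ cong (x ⊕_) (⊕-self y) ⟩
  x ⊕ ∅       ≡⟨ ⊕-identityʳ x ⟩
  x           ∎

⊕-swap : (x y z : Subset k) → x ⊕ (y ⊕ z) ≡ y ⊕ (x ⊕ z)
⊕-swap x y z = begin
  x ⊕ (y ⊕ z) ≡⟨ ⊕-assoc x y z ⟨
  (x ⊕ y) ⊕ z ≡⟨ cong (_⊕ z) (⊕-comm x y) ⟩
  (y ⊕ x) ⊕ z ≡⟨ ⊕-assoc y x z ⟩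
  y ⊕ (x ⊕ z) ∎

⊕-interchange : (w x y z : Subset k) → (w ⊕ x) ⊕ (y ⊕ z) ≡ (w ⊕ y) ⊕ (x ⊕ z)
⊕-interchange w x y z = begin
  (w ⊕ x) ⊕ (y ⊕ z) ≡⟨ ⊕-assoc w x (y ⊕ z) ⟩
  w ⊕ (x ⊕ (y ⊕ z)) ≡⟨ cong (w ⊕_) (⊕-swap x y z) ⟩
  w ⊕ (y ⊕ (x ⊕ z)) ≡⟨ ⊕-assoc w y (x ⊕ z) ⟨
  (w ⊕ y) ⊕ (x ⊕ z) ∎

⊕≡∅⇒≡ : x ⊕ y ≡ ∅ → y ≡ x
⊕≡∅⇒≡ {x = x} {y = y} e = begin
  y           ≡⟨ ⊕-cancelˡ x y ⟨
  x ⊕ (x ⊕ y) ≡⟨ cong (x ⊕_) e ⟩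
  x ⊕ ∅       ≡⟨ ⊕-identityʳ x ⟩
  x           ∎

lincomb-zero : (L : List (Subset k)) → lincomb L (replicate _ false) ≡ ∅
lincomb-zero []      = refl
lincomb-zero (x ∷ L) = trans (cong (∅ ⊕_) (lincomb-zero L)) (⊕-identityˡ ∅)

lincomb-⊕ : (L : List (Subset k)) (c d : Vec Bool (length L)) →
            lincomb L (c ⊕ d) ≡ lincomb L c ⊕ lincomb L d
lincomb-⊕ []      []       []       = sym (⊕-identityˡ ∅)
lincomb-⊕ (x ∷ L) (c ∷ cs) (d ∷ ds) = begin
  sel (c xor d) ⊕ lincomb L (cs ⊕ ds)
    ≡⟨ cong₂ _⊕_ (sel-xor c d) (lincomb-⊕ L cs ds) ⟩
  (sel c ⊕ sel d) ⊕ (lincomb L cs ⊕ lincomb L ds)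
    ≡⟨ ⊕-interchange (sel c) (sel d) (lincomb L cs) (lincomb L ds) ⟩
  (sel c ⊕ lincomb L cs) ⊕ (sel d ⊕ lincomb L ds) ∎
  where
  sel : Bool → Subset _
  sel c = if c then x else ∅
  sel-xor : ∀ c d → sel (c xor d) ≡ sel c ⊕ sel d
  sel-xor true  true  = sym (⊕-self x)
  sel-xor true  false = sym (⊕-identityʳ x)
  sel-xor false true  = sym (⊕-identityˡ x)
  sel-xor false false = sym (⊕-identityˡ ∅)

-- A record rather than a Σ-type so that the list L can be inferred from InSpan L S.
record InSpan (L : List (Subset k)) (S : Subset k) : Set where
  constructor _,_
  field
    coefficients : Vec Bool (length L)
    lincomb≡     : lincomb L coefficients ≡ S

span-∅ : InSpan L ∅
span-∅ {L = L} = replicate _ false , lincomb-zero L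

span-[]⁻ : InSpan [] S → S ≡ ∅
span-[]⁻ ([] , refl) = refl

span-⊕ : InSpan L S → InSpan L T → InSpan L (S ⊕ T)
span-⊕ {L = L} (c , refl) (d , refl) = c ⊕ d , lincomb-⊕ L c d

span-∷⁺ : InSpan L S ⊎ InSpan L (x ⊕ S) → InSpan (x ∷ L) S
span-∷⁺ {S = S} (inj₁ (c , refl)) = false ∷ c , ⊕-identityˡ S
span-∷⁺ {S = S} {x = x} (inj₂ (c , e)) = true ∷ c , trans (cong (x ⊕_) e) (⊕-cancelˡ x S)

span-∷⁻ : InSpan (x ∷ L) S → InSpan L S ⊎ InSpan L (x ⊕ S)
span-∷⁻ {L = L} (false ∷ c , refl) = inj₁ (c , sym (⊕-identityˡ (lincomb L c)))
span-∷⁻ {x = x} {L = L} (true ∷ c , refl) = inj₂ (c , sym (⊕-cancelˡ x (lincomb L c)))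

span-∈ : x ∈ L → InSpan L x
span-∈ {x = x} (here refl) = span-∷⁺ (inj₂ (subst (InSpan _) (sym (⊕-self x)) span-∅))
span-∈ (there x∈L)         = span-∷⁺ (inj₁ (span-∈ x∈L))

span-⨁ : {Ys : List (Subset k)} → All (InSpan L) Ys → InSpan L (⨁ Ys)
span-⨁ []       = span-∅
span-⨁ (s ∷ ss) = span-⊕ s (span-⨁ ss)

span-mono : All (InSpan L′) L → InSpan L S → InSpan L′ S
span-mono {L = []} [] s = subst (InSpan _) (sym (span-[]⁻ s)) span-∅
span-mono {L = x ∷ L} (sx ∷ sL) s with span-∷⁻ s
... | inj₁ s′ = span-mono sL s′
... | inj₂ s′ = subst (InSpan _) (⊕-cancelˡ x _) (span-⊕ sx (span-mono sL s′))

span-↭ : L ↭ L′ → InSpan L S → InSpan L′ S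
span-↭ p = span-mono (All.tabulate (span-∈ ∘ ∈-resp-↭ p))

linIndep-[] : LinIndep {k} []
linIndep-[] [] _ = refl

linIndep-tail : LinIndep (x ∷ L) → LinIndep L
linIndep-tail ind c e = ∷-injectiveʳ (ind (false ∷ c) (trans (⊕-identityˡ _) e))

linIndep-head∉span : LinIndep (x ∷ L) → ¬ InSpan L x
linIndep-head∉span {x = x} ind (c , e) with ind (true ∷ c) (trans (cong (x ⊕_) e) (⊕-self x))
... | ()

linIndep-∷⁺ : LinIndep L → ¬ InSpan L x → LinIndep (x ∷ L)
linIndep-∷⁺ ind x∉L (true ∷ c)  e = ⊥-elim (x∉L (c , ⊕≡∅⇒≡ e))
linIndep-∷⁺ ind x∉L (false ∷ c) e = cong (false ∷_) (ind c (trans (sym (⊕-identityˡ _)) e))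

linIndep-↭ : L ↭ L′ → LinIndep L → LinIndep L′
linIndep-↭ ↭.refl        ind = ind
linIndep-↭ (↭.trans p q) ind = linIndep-↭ q (linIndep-↭ p ind)
linIndep-↭ (↭.prep x p)  ind =
  linIndep-∷⁺ (linIndep-↭ p (linIndep-tail ind))
              (linIndep-head∉span ind ∘ span-↭ (↭-sym p))
linIndep-↭ {L = x ∷ y ∷ L} {L′ = y ∷ x ∷ L′} (↭.swap x y p) ind =
  linIndep-∷⁺ (linIndep-∷⁺ (linIndep-↭ p (linIndep-tail (linIndep-tail ind))) x∉L′) y∉xL′
  where
  x∉yL : ¬ InSpan (y ∷ L) x
  x∉yL = linIndep-head∉span ind
  y∉L : ¬ InSpan L y
  y∉L = linIndep-head∉span (linIndep-tail ind)
  x∉L′ : ¬ InSpan L′ x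
  x∉L′ = x∉yL ∘ span-∷⁺ ∘ inj₁ ∘ span-↭ (↭-sym p)
  y∉xL′ : ¬ InSpan (x ∷ L′) y
  y∉xL′ s with span-∷⁻ s
  ... | inj₁ s′ = y∉L (span-↭ (↭-sym p) s′)
  ... | inj₂ s′ = x∉yL (span-∷⁺ (inj₂ (span-↭ (↭-sym p) (subst (InSpan L′) (⊕-comm x y) s′))))

linIndep⇒unique : LinIndep L → Unique L
linIndep⇒unique {L = []}    _   = []
linIndep⇒unique {L = x ∷ L} ind =
  All.tabulate (λ y∈L x≡y → linIndep-head∉span ind (span-∈ (subst (_∈ L) (sym x≡y) y∈L)))
  ∷ linIndep⇒unique (linIndep-tail ind)

linIndep-exchange : InSpan R (b ⊕ y) → LinIndep (b ∷ R) → LinIndep (y ∷ R)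
linIndep-exchange {R = R} {b = b} {y = y} s ind =
  linIndep-∷⁺ (linIndep-tail ind)
    (λ sy → linIndep-head∉span ind (subst (InSpan R) (⊕-cancelʳ b y) (span-⊕ s sy)))

span-exchange : InSpan R (b ⊕ y) → InSpan (b ∷ R) S → InSpan (y ∷ R) S
span-exchange {R = R} {b = b} {y = y} s =
  span-mono (span-∷⁺ (inj₂ (subst (InSpan R) (⊕-comm b y) s)) ∷
             All.tabulate (span-∈ ∘ there))

SumOver : Pred (Subset k) 0ℓ → List (Subset k) → Subset k → Set
SumOver P L S = Σ (List (Subset _)) λ Ys → Unique Ys × All (_∈ L) Ys × All P Ys × S ≡ ⨁ Ys

-- b occurs in the expansion of S over L ↭ b ∷ R.
Pivot : Pred (Subset k) 0ℓ → List (Subset k) → Subset k → Set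
Pivot P L S =
  Σ (Subset _) λ b → ¬ P b × Σ (List (Subset _)) λ R → L ↭ b ∷ R × InSpan R (b ⊕ S)

pivot-∷ : {P : Pred (Subset k) 0ℓ} {a : Subset k} →
          Pivot P L S ⊎ Pivot P L (a ⊕ S) → Pivot P (a ∷ L) S
pivot-∷ {a = a} (inj₁ (b , ¬Pb , R , p , s)) =
  b , ¬Pb , a ∷ R , ↭.trans (↭.prep a p) (↭.swap a b ↭.refl) , span-∷⁺ (inj₁ s)
pivot-∷ {S = S} {a = a} (inj₂ (b , ¬Pb , R , p , s)) =
  b , ¬Pb , a ∷ R , ↭.trans (↭.prep a p) (↭.swap a b ↭.refl) ,
  span-∷⁺ (inj₂ (subst (InSpan R) (⊕-swap b a S) s))

sumOver⊎pivot : {P : Pred (Subset k) 0ℓ} → Decidable P →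
                Unique L → InSpan L S → SumOver P L S ⊎ Pivot P L S
sumOver⊎pivot {L = []} P? [] s = inj₁ ([] , [] , [] , [] , span-[]⁻ s)
sumOver⊎pivot {L = a ∷ L} {S = S} {P = P} P? (a∉L ∷ unique) s with span-∷⁻ s
... | inj₁ s′ = Sum.map skip (pivot-∷ ∘ inj₁) (sumOver⊎pivot P? unique s′)
  where
  skip : SumOver P L S → SumOver P (a ∷ L) S
  skip (Ys , uYs , Ys⊆L , PYs , e) = Ys , uYs , All.map there Ys⊆L , PYs , e
... | inj₂ s′ with P? a
...   | no ¬Pa = inj₂ (a , ¬Pa , L , ↭.refl , s′)
...   | yes Pa = Sum.map keep (pivot-∷ ∘ inj₂) (sumOver⊎pivot P? unique s′)
  where
  keep : SumOver P L (a ⊕ S) → SumOver P (a ∷ L) S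
  keep (Ys , uYs , Ys⊆L , PYs , e) =
    a ∷ Ys , All.map (All.lookup a∉L) Ys⊆L ∷ uYs , here refl ∷ All.map there Ys⊆L ,
    Pa ∷ PYs , trans (sym (⊕-cancelˡ a S)) (cong (a ⊕_) e)

⨁-filter : {P : Pred (Subset k) 0ℓ} (P? : Decidable P) (xs : List (Subset k)) →
           ⨁ xs ≡ ⨁ (filter P? xs) ⊕ ⨁ (filter (¬? ∘ P?) xs)
⨁-filter P? []       = sym (⊕-identityˡ ∅)
⨁-filter P? (x ∷ xs) with P? x
... | yes _ = trans (cong (x ⊕_) (⨁-filter P? xs)) (sym (⊕-assoc x _ _))
... | no  _ = trans (cong (x ⊕_) (⨁-filter P? xs)) (⊕-swap x _ _)

∈⇒↭∷ : {A : Set} {x : A} {xs : List A} → x ∈ xs → Σ (List A) λ ys → xs ↭ x ∷ ys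
∈⇒↭∷ {x = x} x∈xs with ys , zs , refl ← ∈-∃++ x∈xs = ys ++ zs , shift x ys zs

∈-↭∷⁻ : {A : Set} {x y : A} {xs ys : List A} →
        xs ↭ x ∷ ys → y ∈ xs → x ≢ y → y ∈ ys
∈-↭∷⁻ p y∈xs x≢y with ∈-resp-↭ p y∈xs
... | here refl = ⊥-elim (x≢y refl)
... | there y∈ys = y∈ys

⊆-∷⁺ : {A : Set} {x : A} {xs ys : List A} →
       x ∈ ys → (∀ z → z ∈ xs → z ∈ ys) → ∀ z → z ∈ x ∷ xs → z ∈ ys
⊆-∷⁺ x∈ys xs⊆ys _ (here refl) = x∈ys
⊆-∷⁺ x∈ys xs⊆ys z (there z∈xs) = xs⊆ys z z∈xs

allSubsets : (n : ℕ) → List (Subset n)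
allSubsets zero    = [] ∷ []
allSubsets (suc n) = map (true ∷_) (allSubsets n) ++ map (false ∷_) (allSubsets n)

∈-allSubsets : ∀ {n} (p : Subset n) → p ∈ allSubsets n
∈-allSubsets []                  = here refl
∈-allSubsets (true ∷ p)          = ∈-++⁺ˡ (∈-map⁺ (true ∷_) (∈-allSubsets p))
∈-allSubsets {suc n} (false ∷ p) =
  ∈-++⁺ʳ (map (true ∷_) (allSubsets n)) (∈-map⁺ (false ∷_) (∈-allSubsets p))

_∈?_ : (x : Subset k) (L : List (Subset k)) → Dec (x ∈ L)
x ∈? L = any? (≡-dec Bool._≟_ x) L

inSpan? : (L : List (Subset k)) → Decidable (InSpan L)
inSpan? L S = map′ (λ (c , e) → c , e) (λ (c , e) → c , e)
  (anySubset? (λ c → ≡-dec Bool._≟_ (lincomb L c) S))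

SumOfShorterCycles : (G : Graph) → EdgeSet G → EdgeSet G → Set
SumOfShorterCycles G C S =
  Σ (List (EdgeSet G)) λ Y →
    Unique Y × All (IsCycle G) Y × All (λ D → size D < size C) Y × S ≡ ⨁ Y

ShortRelation : (G : Graph) → EdgeSet G → List (EdgeSet G) → Set
ShortRelation G C X =
  Σ (List (EdgeSet G)) λ Cs →
    Unique (C ∷ Cs) × All (_∈ X) Cs × SumOfShorterCycles G C (C ⊕ ⨁ Cs)

ShortDependency : (G : Graph) → List (EdgeSet G) → Set
ShortDependency G X =
  Σ (EdgeSet G) λ C₁ → Σ (List (EdgeSet G)) λ Cs →
    Unique (C₁ ∷ Cs) × All (_∈ X) (C₁ ∷ Cs) × SumOfShorterCycles G C₁ (⨁ (C₁ ∷ Cs))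

module _ {G : Graph} where

  private variable
    B C : EdgeSet G
    M N X : List (EdgeSet G)

  isCycle? : Decidable (IsCycle G)
  isCycle? C = all? (λ v → degree G C v % 2 ℕ.≟ 0)

  relevant⇒cycle : IsRelevant G C → IsCycle G C
  relevant⇒cycle (_ , ((cycles , _) , _) , C∈M) = All.lookup cycles C∈M

  basis-spans : IsCycleBasis G M → IsCycle G C → InSpan M C
  basis-spans (_ , _ , spanning) C-cycle with c , e ← spanning _ C-cycle = c , e

  isCycleBasis : All (IsCycle G) M → LinIndep M → (∀ {C} → IsCycle G C → InSpan M C) →
                 IsCycleBasis G M
  isCycleBasis cycles ind spanning =
    cycles , ind , λ C C-cycle → let c , e = spanning C-cycle in c , e

  isCycleBasis-↭ : M ↭ N → IsCycleBasis G M → IsCycleBasis G N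
  isCycleBasis-↭ p basis@(cycles , ind , _) =
    isCycleBasis (All-resp-↭ p cycles) (linIndep-↭ p ind) (span-↭ p ∘ basis-spans basis)

  isMCB-↭ : M ↭ N → IsMCB G M → IsMCB G N
  isMCB-↭ p (basis , minimal) =
    isCycleBasis-↭ p basis ,
    λ B′ b′ → subst (_≤ weight B′) (sum-↭ (map⁺ size p)) (minimal B′ b′)

  isCycleBasis-exchange : InSpan M (B ⊕ C) → IsCycle G C →
                          IsCycleBasis G (B ∷ M) → IsCycleBasis G (C ∷ M)
  isCycleBasis-exchange s C-cycle basis@(_ ∷ cycles , ind , _) =
    isCycleBasis (C-cycle ∷ cycles) (linIndep-exchange s ind) (span-exchange s ∘ basis-spans basis)

  isMCB-exchange : InSpan M (B ⊕ C) → IsCycle G C → size C ≤ size B →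
                   IsMCB G (B ∷ M) → IsMCB G (C ∷ M)
  isMCB-exchange {M = M} s C-cycle C≤B (basis , minimal) =
    isCycleBasis-exchange s C-cycle basis ,
    λ B′ b′ → ≤-trans (+-monoˡ-≤ (weight M) C≤B) (minimal B′ b′)

  isMCB-exchange⇒≤ : InSpan M (B ⊕ C) → IsCycle G C → IsMCB G (B ∷ M) → size B ≤ size C
  isMCB-exchange⇒≤ {M = M} s C-cycle (basis , minimal) =
    +-cancelʳ-≤ (weight M) _ _ (minimal _ (isCycleBasis-exchange s C-cycle basis))

  shorter-cycle∈span-tail : IsMCB G (B ∷ M) → IsCycle G C → size C < size B → InSpan M C
  shorter-cycle∈span-tail mcb@(basis , _) C-cycle C<B with span-∷⁻ (basis-spans basis C-cycle)
  ... | inj₁ s = s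
  ... | inj₂ s = ⊥-elim (<⇒≱ C<B (isMCB-exchange⇒≤ s C-cycle mcb))

  greedyBasis : (Zs : List (EdgeSet G)) →
    Σ (List (EdgeSet G)) λ M →
      All (IsCycle G) M × LinIndep M × All (λ Z → IsCycle G Z → InSpan M Z) Zs
  greedyBasis [] = [] , [] , linIndep-[] , []
  greedyBasis (Z ∷ Zs) with greedyBasis Zs
  ... | M , cycles , ind , covered with inSpan? M Z | isCycle? Z
  ...   | yes Z∈M | _         = M , cycles , ind , (λ _ → Z∈M) ∷ covered
  ...   | no  _   | no ¬cycle = M , cycles , ind , (⊥-elim ∘ ¬cycle) ∷ covered
  ...   | no  Z∉M | yes cycle =
    Z ∷ M , cycle ∷ cycles , linIndep-∷⁺ ind Z∉M ,
    (λ _ → span-∈ (here refl)) ∷ All.map (λ s c → span-∷⁺ (inj₁ (s c))) covered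

  cycleBasis : Σ (List (EdgeSet G)) (IsCycleBasis G)
  cycleBasis with M , cycles , ind , covered ← greedyBasis (allSubsets (m G)) =
    M , isCycleBasis cycles ind (λ {C} → All.lookup covered (∈-allSubsets C))

  -- Constructively only the double negation; it is only used to refute ¬ MutuallyRelevant G [].
  mcb-¬¬exists : ¬ ¬ Σ (List (EdgeSet G)) (IsMCB G)
  mcb-¬¬exists ∄mcb = lightest (proj₂ cycleBasis) (<-wellFounded _)
    where
    lightest : IsCycleBasis G M → Acc _<_ (weight M) → ⊥
    lightest {M} basis (acc lighter) =
      ∄mcb (M , basis , λ B′ b′ → ≮⇒≥ (λ B′<M → lightest b′ (lighter B′<M)))

  mcb-no-short-relation : {Cs : List (EdgeSet G)} →
    IsMCB G (B ∷ M) → All (_∈ M) Cs → ¬ SumOfShorterCycles G B (B ⊕ ⨁ Cs)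
  mcb-no-short-relation {B = B} {M = M} {Cs = Cs} mcb@((_ , ind , _) , _) Cs⊆M
                        (Y , _ , cycles , shorter , sum) =
    linIndep-head∉span ind
      (subst (InSpan M) B≡ (span-⊕ (span-⨁ Y∈M) (span-⨁ (All.map span-∈ Cs⊆M))))
    where
    B≡ : ⨁ Y ⊕ ⨁ Cs ≡ B
    B≡ = trans (cong (_⊕ ⨁ Cs) (sym sum)) (⊕-cancelʳ B (⨁ Cs))
    Y∈M : All (InSpan M) Y
    Y∈M = All.zipWith (λ (cycle , short) → shorter-cycle∈span-tail mcb cycle short)
                      (cycles , shorter)

  shortRelation-of-sum : ¬ C ∈ M → All (IsCycle G) M →
    SumOver (λ Y → size Y < size C ⊎ Y ∈ X) M C → ShortRelation G C X
  shortRelation-of-sum {C = C} {M = M} {X = X} C∉M cycles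
                       (Ys , unique , Ys⊆M , short-or-in-X , C≡) =
    filter long? Ys ,
    All.map (λ Y∈M C≡Y → C∉M (subst (_∈ M) (sym C≡Y) Y∈M)) (filter⁺ long? Ys⊆M) ∷
      Unique.filter⁺ long? unique ,
    All.zipWith in-X (filter⁺ long? short-or-in-X , all-filter long? Ys) ,
    filter short? Ys , Unique.filter⁺ short? unique ,
    All.map (All.lookup cycles) (filter⁺ short? Ys⊆M) , all-filter short? Ys , sum
    where
    short? : Decidable (λ Y → size Y < size C)
    short? Y = size Y <? size C
    long? : Decidable (λ Y → ¬ size Y < size C)
    long? = ¬? ∘ short?
    in-X : ∀ {Y} → (size Y < size C ⊎ Y ∈ X) × ¬ size Y < size C → Y ∈ X
    in-X (inj₁ Y<C , Y≮C) = ⊥-elim (Y≮C Y<C)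
    in-X (inj₂ Y∈X , _)   = Y∈X
    sum : C ⊕ ⨁ (filter long? Ys) ≡ ⨁ (filter short? Ys)
    sum = trans (cong (_⊕ ⨁ (filter long? Ys)) (trans C≡ (⨁-filter short? Ys)))
                (⊕-cancelʳ _ _)

  mutual-insert⊎relation : MutuallyRelevant G X → IsCycle G C →
    MutuallyRelevant G (C ∷ X) ⊎ ShortRelation G C X
  mutual-insert⊎relation {X = X} {C = C} (M , mcb@(basis@(cycles , ind , _) , _) , X⊆M) C-cycle
    with C ∈? M
  ... | yes C∈M = inj₁ (M , mcb , ⊆-∷⁺ C∈M X⊆M)
  ... | no  C∉M
    with sumOver⊎pivot (λ Y → (size Y <? size C) ⊎-dec (Y ∈? X))
                       (linIndep⇒unique ind) (basis-spans basis C-cycle)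
  ...   | inj₁ sum = inj₂ (shortRelation-of-sum C∉M cycles sum)
  ...   | inj₂ (B , ¬PB , R , M↭ , s) =
    inj₁ (C ∷ R , isMCB-exchange s C-cycle (≮⇒≥ (¬PB ∘ inj₁)) (isMCB-↭ M↭ mcb) ,
          ⊆-∷⁺ (here refl) λ D D∈X → there (∈-↭∷⁻ M↭ (X⊆M D D∈X) (B≢ D∈X)))
    where
    B≢ : ∀ {D} → D ∈ X → B ≢ D
    B≢ D∈X refl = ¬PB (inj₂ D∈X)

  mutual⊎dependency : IsMCB G M → All (IsCycle G) X → MutuallyRelevant G X ⊎ ShortDependency G X
  mutual⊎dependency {M = M} mcb [] = inj₁ (M , mcb , λ _ ())
  mutual⊎dependency mcb (C-cycle ∷ cycles) with mutual⊎dependency mcb cycles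
  ... | inj₂ (C₁ , Cs , unique , Cs⊆X , sum) =
    inj₂ (C₁ , Cs , unique , All.map there Cs⊆X , sum)
  ... | inj₁ mr with mutual-insert⊎relation mr C-cycle
  ...   | inj₁ mr′ = inj₁ mr′
  ...   | inj₂ (Cs , unique , Cs⊆X , sum) =
    inj₂ (_ , Cs , unique , here refl ∷ All.map there Cs⊆X , sum)

  ¬mutual⇒dependency : (∀ C → C ∈ X → IsRelevant G C) →
                       ¬ MutuallyRelevant G X → ShortDependency G X
  ¬mutual⇒dependency {X = []} _ ¬mutual =
    ⊥-elim (mcb-¬¬exists λ (M , mcb) → ¬mutual (M , mcb , λ _ ()))
  ¬mutual⇒dependency {X = C ∷ X} relevant ¬mutual with _ , mcb , _ ← relevant C (here refl) =
    Sum.fromInj₂ (⊥-elim ∘ ¬mutual)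
      (mutual⊎dependency mcb (All.tabulate (relevant⇒cycle ∘ relevant _)))

  dependency⇒¬mutual : ShortDependency G X → ¬ MutuallyRelevant G X
  dependency⇒¬mutual {X = X} (C₁ , Cs , C₁∉Cs ∷ _ , C₁∈X ∷ Cs⊆X , sum) (M , mcb , X⊆M)
    with R , M↭ ← ∈⇒↭∷ (X⊆M C₁ C₁∈X) =
    mcb-no-short-relation (isMCB-↭ M↭ mcb) (All.zipWith in-R (Cs⊆X , C₁∉Cs)) sum
    where
    in-R : ∀ {C} → C ∈ X × C₁ ≢ C → C ∈ R
    in-R (C∈X , C₁≢C) = ∈-↭∷⁻ M↭ (X⊆M _ C∈X) C₁≢C

lemma11 : (G : Graph) (X : List (EdgeSet G)) →
    (∀ C → C ∈ X → IsRelevant G C) →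
    (∀ C D → C ∈ X → D ∈ X → size C ≡ size D) →
    (¬ MutuallyRelevant G X) ⇔
      (Σ (EdgeSet G) λ C₁ → Σ (List (EdgeSet G)) λ Cs →
        Unique (C₁ ∷ Cs) × All (λ C → C ∈ X) (C₁ ∷ Cs) ×
        Σ (List (EdgeSet G)) λ Y →
          Unique Y × All (IsCycle G) Y × All (λ C → size C < size C₁) Y ×
          ⨁ (C₁ ∷ Cs) ≡ ⨁ Y)
lemma11 G X relevant _ = mk⇔ (¬mutual⇒dependency {G = G} relevant) (dependency⇒¬mutual {G = G})
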